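{- Fix an integer $n>0$. Then $I=\langle F_1\rangle$, where $I = \langle y_1+\cdots+y_n, y_1^2,\dots,y_n^2\rangle$ and $F_1=\{g_1, g_{011}, y_2^2,\dots,y_n^2\}$ with $g_1 = y_1+y_2+\cdots+y_n$ and $g_{011}=\sum_{2\le i<j\le n} y_iy_j$.
   Context: Let $K$ be a field of characteristic $0$ and $R = K[y_1,\dots,y_n]$. In general, for an integer $\ell\ge -1$, $F_\ell = \{y_2^2,\dots,y_n^2\}\cup\{g_\alpha : \alpha \text{ an MCP of length } n,\ \ell_1(\alpha)-1\le\ell\}$, where an MCP (Modified Catalan Path) is a bitstring $\alpha=w\,1\,0^m\in\{0,1\}^n$ with $w\in\{0,1\}^{2l}$ having $l$ zeros and $l$ ones and every prefix having at least as many zeros as ones; $\ell_1(\alpha)$ is the number of ones; $g_\alpha = y^\alpha+\sum_{\beta\in P_\alpha} y^\beta$ with $P_\alpha=\{\beta\in\{0,1\}^n:\beta\neq\alpha,\ \ell_1(\beta)=\ell_1(\alpha),\ \alpha_i=0\Rightarrow\beta_i=0 \text{ for } 1\le i\le 2\ell_1(\alpha)-1\}$. For $\ell=1$ the MCPs are $1\,0^{n-1}$ and $011\,0^{n-3}$, giving $g_1$ and $g_{011}$ as stated. -}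

module Defs where

open import Level using (_⊔_)
open import Algebra.Bundles using (CommutativeRing)
open import Data.Nat using (ℕ; zero; suc; _<_; _≤_; _<?_; _≤?_)
import Data.Nat.Properties as ℕP
open import Data.Fin using (Fin; toℕ)
open import Data.Vec using (Vec; tabulate; zipWith)
import Data.Vec.Properties as VecP
open import Data.List using (List; []; _∷_; _++_; concat; concatMap; map; allFin; foldr)
open import Data.Product using (_×_; _,_; ∃; Σ)
open import Data.Bool using (Bool; true; false; if_then_else_; _∧_)
open import Relation.Nullary using (¬_; does)
open import Relation.Binary.PropositionalEquality using (_≡_)

module _ {c ℓ} (R : CommutativeRing c ℓ) where
  open CommutativeRing R

  IsField : Set (c ⊔ ℓ)
  IsField = (¬ (0# ≈ 1#)) × (∀ x → ¬ (x ≈ 0#) → ∃ λ y → x * y ≈ 1#)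

  natR : ℕ → Carrier
  natR zero = 0#
  natR (suc m) = 1# + natR m

  CharZero : Set ℓ
  CharZero = ∀ m → ¬ (natR (suc m) ≈ 0#)

  -- The polynomial ring R[y_1,…,y_n] : a polynomial is a finite formal sum of
  -- terms (coefficient, exponent vector); variables y_{i+1} are indexed by i : Fin n.
  Poly : ℕ → Set c
  Poly n = List (Carrier × Vec ℕ n)

  coeff : ∀ {n} → Poly n → Vec ℕ n → Carrier
  coeff [] e = 0#
  coeff ((a , d) ∷ p) e with VecP.≡-dec ℕP._≟_ d e
  ... | Relation.Nullary.yes _ = a + coeff p e
  ... | Relation.Nullary.no _ = coeff p e

  _≈P_ : ∀ {n} → Poly n → Poly n → Set ℓ
  _≈P_ {n} p q = ∀ (e : Vec ℕ n) → coeff p e ≈ coeff q e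

  0P : ∀ {n} → Poly n
  0P = []

  _+P_ : ∀ {n} → Poly n → Poly n → Poly n
  p +P q = p ++ q

  _*P_ : ∀ {n} → Poly n → Poly n → Poly n
  p *P q = concatMap (λ { (a , d) → map (λ { (b , e) → (a * b , zipWith Data.Nat._+_ d e) }) q }) p

  sumP : ∀ {n} → List (Poly n) → Poly n
  sumP = concat

  var : ∀ {n} → Fin n → Poly n
  var {n} i = (1# , tabulate (λ j → if does (toℕ i Data.Nat.≟ toℕ j) then 1 else 0)) ∷ []

  _∈⟨_⟩ : ∀ {n} → Poly n → List (Poly n) → Set (c ⊔ ℓ)
  _∈⟨_⟩ {n} f G = ∃ λ (hs : List (Poly n)) → Data.List.length hs ≡ Data.List.length G
                 × (f ≈P sumP (Data.List.zipWith _*P_ hs G))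

  SameIdeal : ∀ {n} → List (Poly n) → List (Poly n) → Set (c ⊔ ℓ)
  SameIdeal {n} A B = ∀ (f : Poly n) → ((f ∈⟨ A ⟩ → f ∈⟨ B ⟩) × (f ∈⟨ B ⟩ → f ∈⟨ A ⟩))

  g1 : ∀ n → Poly n
  g1 n = sumP (map var (allFin n))

  -- Σ_{2 ≤ i < j ≤ n} y_i y_j   (0-based: 1 ≤ i < j)
  g011 : ∀ n → Poly n
  g011 n = sumP (concatMap (λ i → map (λ j →
             if does (1 ≤? toℕ i) ∧ does (toℕ i <? toℕ j) then var i *P var j else 0P)
             (allFin n)) (allFin n))

  I-gens : ∀ n → List (Poly n)
  I-gens n = g1 n ∷ map (λ i → var i *P var i) (allFin n)

  F1 : ∀ n → List (Poly n)
  F1 n = g1 n ∷ g011 n ∷ concatMap (λ i → if does (1 ≤? toℕ i) then (var i *P var i) ∷ [] else []) (allFin n)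

module Submission where

-- Write g₁ = y₁ + s with s = y₂ + ⋯ + yₙ, and let q = y₂² + ⋯ + yₙ². Expanding the square of s gives
-- s² = q + 2 g₀₁₁. Hence y₁² = y₁ g₁ + s² − s g₁ lies in ⟨F₁⟩, which gives I ⊆ ⟨F₁⟩. Conversely
-- s² = g₁² + y₁² − 2 y₁ g₁ lies in I, so 2 g₀₁₁ = s² − q ∈ I, and g₀₁₁ ∈ I because 2 is invertible.

open import Defs
open import Algebra.Bundles using (CommutativeRing)
open import Algebra.Consequences.Setoid using (comm∧idˡ⇒id; comm∧distrˡ⇒distr)
import Algebra.Solver.Ring.NaturalCoefficients.Default as NaturalCoefficients
open import Data.Bool using (true; if_then_else_; _∧_)
open import Data.Empty using (⊥-elim)
open import Data.Fin using (Fin; zero; suc; toℕ)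
open import Data.List using (List; []; _∷_; _++_; foldr; zipWith; replicate; length; map; concat; allFin; tabulate)
import Data.List.Properties as List
open import Data.List.Membership.Propositional using (_∈_; lose)
open import Data.List.Membership.Propositional.Properties using (∈-map⁺; ∈-map⁻; ∈-allFin; ∈-concatMap⁺; ∈-concatMap⁻)
open import Data.List.Relation.Unary.Any using (here; there; satisfied)
open import Data.Nat as ℕ using (ℕ; zero; suc; _<_)
import Data.Nat.Properties as ℕ
open import Data.Product using (_×_; _,_; ∃; proj₁; proj₂)
open import Data.Sum using (_⊎_; inj₁; inj₂)
open import Data.Vec using (Vec; []; _∷_)
import Data.Vec as Vec
import Data.Vec.Properties as Vec
open import Function using (_∘_)
open import Level using (_⊔_)
open import Relation.Binary.Bundles using (Setoid)
open import Relation.Binary.PropositionalEquality as ≡ using (_≡_; _≢_)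
import Relation.Binary.Reasoning.Setoid as SetoidReasoning
open import Relation.Binary.Structures using (IsEquivalence)
open import Relation.Nullary using (yes; no; does)

private
  variable
    n : ℕ

_+ᵉ_ : Vec ℕ n → Vec ℕ n → Vec ℕ n
_+ᵉ_ = Vec.zipWith ℕ._+_

_∸ᵉ_ : Vec ℕ n → Vec ℕ n → Vec ℕ n
_∸ᵉ_ = Vec.zipWith ℕ._∸_

+ᵉ-cancelˡ : (d x y : Vec ℕ n) → d +ᵉ x ≡ d +ᵉ y → x ≡ y
+ᵉ-cancelˡ [] [] [] _ = ≡.refl
+ᵉ-cancelˡ (a ∷ d) (x ∷ xs) (y ∷ ys) eq =
  ≡.cong₂ _∷_ (ℕ.+-cancelˡ-≡ a x y (proj₁ (Vec.∷-injective eq)))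
              (+ᵉ-cancelˡ d xs ys (proj₂ (Vec.∷-injective eq)))

+ᵉ-∸ᵉ : (d x : Vec ℕ n) → (d +ᵉ x) ∸ᵉ d ≡ x
+ᵉ-∸ᵉ [] [] = ≡.refl
+ᵉ-∸ᵉ (a ∷ d) (x ∷ xs) = ≡.cong₂ _∷_ (ℕ.m+n∸m≡n a x) (+ᵉ-∸ᵉ d xs)

+ᵉ-divides? : (d e : Vec ℕ n) → (∃ λ x → d +ᵉ x ≡ e) ⊎ (∀ x → d +ᵉ x ≢ e)
+ᵉ-divides? d e with Vec.≡-dec ℕ._≟_ (d +ᵉ (e ∸ᵉ d)) e
... | yes eq = inj₁ (e ∸ᵉ d , eq)
... | no neq = inj₂ λ { x ≡.refl → neq (≡.cong (d +ᵉ_) (+ᵉ-∸ᵉ d x)) }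

module RingIdentities {c ℓ} (R : CommutativeRing c ℓ) where
  open CommutativeRing R hiding (zero)
  open import Algebra.Properties.Semiring.Sum semiring
  open SetoidReasoning setoid
  open NaturalCoefficients commutativeSemiring using (solve; _:=_; _:+_; _:*_)

  -- The guard is written as in g011, so that g011 unfolds to this sum.
  ∑< : ∀ {m} → (Fin m → Fin m → Carrier) → Carrier
  ∑< {m} f = ∑[ i < m ] ∑[ j < m ] (if does (toℕ i ℕ.<? toℕ j) then f i j else 0#)

  ∑<-suc : ∀ {m} (f : Fin (suc m) → Fin (suc m) → Carrier) →
           ∑< f ≈ ∑[ j < m ] f zero (suc j) + ∑< (λ i j → f (suc i) (suc j))
  ∑<-suc {m} f = +-cong (+-identityˡ _) (sum-cong-≋ {m} (λ i → +-identityˡ _))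

  square-of-sum : ∀ {m} (x : Fin m → Carrier) →
    sum x * sum x ≈ ∑[ i < m ] (x i * x i) + (∑< (λ i j → x i * x j) + ∑< (λ i j → x i * x j))
  square-of-sum {zero} x = trans (zeroˡ 0#) (sym (trans (+-identityˡ _) (+-identityˡ _)))
  square-of-sum {suc m} x = begin
    (x₀ + s) * (x₀ + s)
      ≈⟨ solve 2 (λ a b → (a :+ b) :* (a :+ b) := a :* a :+ (a :* b :+ a :* b) :+ b :* b) refl x₀ s ⟩
    x₀ * x₀ + (x₀ * s + x₀ * s) + s * s
      ≈⟨ +-cong (+-congˡ (+-cong x₀s≈A x₀s≈A)) (square-of-sum x′) ⟩
    x₀ * x₀ + (A + A) + (Q′ + (P′ + P′))
      ≈⟨ solve 4 (λ a b c d → a :+ (b :+ b) :+ (c :+ (d :+ d)) := a :+ c :+ ((b :+ d) :+ (b :+ d)))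
               refl (x₀ * x₀) A Q′ P′ ⟩
    x₀ * x₀ + Q′ + ((A + P′) + (A + P′))
      ≈⟨ +-congˡ (+-cong (∑<-suc xx) (∑<-suc xx)) ⟨
    x₀ * x₀ + Q′ + (∑< xx + ∑< xx)
      ∎
    where
    x₀ s A Q′ P′ : Carrier
    x′ : Fin m → Carrier
    xx : Fin (suc m) → Fin (suc m) → Carrier
    x₀ = x zero
    x′ i = x (suc i)
    s = sum x′
    xx i j = x i * x j
    A = ∑[ j < m ] (x₀ * x′ j)
    Q′ = ∑[ i < m ] (x′ i * x′ i)
    P′ = ∑< (λ i j → x′ i * x′ j)
    x₀s≈A : x₀ * s ≈ A
    x₀s≈A = *-distribˡ-sum x₀ x′

  open import Algebra.Properties.AbelianGroup +-abelianGroup using (x≈z//y)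

  -- The solver has natural-number coefficients, so it proves the subtraction-free form of each
  -- identity and the subtracted term is then moved across.
  x*x≈x*[x+y]+y*y-y*[x+y] : ∀ x y → x * x ≈ x * (x + y) + y * y - y * (x + y)
  x*x≈x*[x+y]+y*y-y*[x+y] x y = x≈z//y (x * x) (y * (x + y)) _
    (solve 2 (λ a b → a :* a :+ b :* (a :+ b) := a :* (a :+ b) :+ b :* b) refl x y)

  y*y≈[x+y]*[x+y]+x*x-[x+x]*[x+y] : ∀ x y → y * y ≈ (x + y) * (x + y) + x * x - (x + x) * (x + y)
  y*y≈[x+y]*[x+y]+x*x-[x+x]*[x+y] x y = x≈z//y (y * y) ((x + x) * (x + y)) _
    (solve 2 (λ a b → b :* b :+ (a :+ a) :* (a :+ b) := (a :+ b) :* (a :+ b) :+ a :* a) refl x y)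

  x≈c*[x+x] : ∀ {c} → c * (1# + 1#) ≈ 1# → ∀ x → x ≈ c * (x + x)
  x≈c*[x+x] {c} c*2≈1 x = begin
    x                   ≈⟨ *-identityˡ x ⟨
    1# * x              ≈⟨ *-congʳ c*2≈1 ⟨
    c * (1# + 1#) * x   ≈⟨ *-assoc c _ x ⟩
    c * ((1# + 1#) * x) ≈⟨ *-congˡ (trans (distribʳ x 1# 1#) (+-cong (*-identityˡ x) (*-identityˡ x))) ⟩
    c * (x + x)         ∎

module Ideal {c ℓ} (R : CommutativeRing c ℓ) where
  open CommutativeRing R hiding (zero)
  open import Algebra.Properties.Ring ring using (-1*x≈-x)
  open import Algebra.Properties.CommutativeSemigroup +-commutativeSemigroup using (interchange)
  open import Algebra.Properties.Semiring.Sum semiring using (sum)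
  open SetoidReasoning setoid

  combination : List Carrier → List Carrier → Carrier
  combination hs gs = foldr _+_ 0# (zipWith _*_ hs gs)

  infix 4 _∈⟨_⟩ᵣ
  _∈⟨_⟩ᵣ : Carrier → List Carrier → Set (c ⊔ ℓ)
  f ∈⟨ gs ⟩ᵣ = ∃ λ hs → length hs ≡ length gs × f ≈ combination hs gs

  combination-zeros : ∀ gs → combination (replicate (length gs) 0#) gs ≈ 0#
  combination-zeros [] = refl
  combination-zeros (g ∷ gs) = trans (+-cong (zeroˡ g) (combination-zeros gs)) (+-identityˡ 0#)

  combination-+ : ∀ hs hs′ gs → length hs ≡ length gs → length hs′ ≡ length gs →
    combination (zipWith _+_ hs hs′) gs ≈ combination hs gs + combination hs′ gs
  combination-+ [] [] [] _ _ = sym (+-identityˡ 0#)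
  combination-+ (h ∷ hs) (h′ ∷ hs′) (g ∷ gs) eq eq′ = begin
    (h + h′) * g + combination (zipWith _+_ hs hs′) gs
      ≈⟨ +-cong (distribʳ g h h′) (combination-+ hs hs′ gs (ℕ.suc-injective eq) (ℕ.suc-injective eq′)) ⟩
    (h * g + h′ * g) + (combination hs gs + combination hs′ gs)
      ≈⟨ interchange _ _ _ _ ⟩
    (h * g + combination hs gs) + (h′ * g + combination hs′ gs) ∎

  combination-*ˡ : ∀ a hs gs → combination (map (a *_) hs) gs ≈ a * combination hs gs
  combination-*ˡ a [] gs = sym (zeroʳ a)
  combination-*ˡ a (h ∷ hs) [] = sym (zeroʳ a)
  combination-*ˡ a (h ∷ hs) (g ∷ gs) = begin
    a * h * g + combination (map (a *_) hs) gs ≈⟨ +-cong (*-assoc a h g) (combination-*ˡ a hs gs) ⟩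
    a * (h * g) + a * combination hs gs        ≈⟨ distribˡ a _ _ ⟨
    a * (h * g + combination hs gs)            ∎

  ∈⟨⟩ᵣ-resp-≈ : ∀ {f f′ gs} → f ≈ f′ → f ∈⟨ gs ⟩ᵣ → f′ ∈⟨ gs ⟩ᵣ
  ∈⟨⟩ᵣ-resp-≈ f≈f′ (hs , len , f≈) = hs , len , trans (sym f≈f′) f≈

  0∈⟨⟩ᵣ : ∀ gs → 0# ∈⟨ gs ⟩ᵣ
  0∈⟨⟩ᵣ gs = replicate (length gs) 0# , List.length-replicate (length gs) , sym (combination-zeros gs)

  ∈⇒∈⟨⟩ᵣ : ∀ {g gs} → g ∈ gs → g ∈⟨ gs ⟩ᵣ
  ∈⇒∈⟨⟩ᵣ {g} {_ ∷ gs} (here ≡.refl) =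
    1# ∷ replicate (length gs) 0# , ≡.cong suc (List.length-replicate (length gs)) , (begin
      g                                                ≈⟨ +-identityʳ g ⟨
      g + 0#                                           ≈⟨ +-cong (*-identityˡ g) (combination-zeros gs) ⟨
      1# * g + combination (replicate (length gs) 0#) gs ∎)
  ∈⇒∈⟨⟩ᵣ {g} {g′ ∷ gs} (there g∈gs) with ∈⇒∈⟨⟩ᵣ g∈gs
  ... | hs , len , g≈ = 0# ∷ hs , ≡.cong suc len , (begin
    g                               ≈⟨ g≈ ⟩
    combination hs gs               ≈⟨ +-identityˡ _ ⟨
    0# + combination hs gs          ≈⟨ +-congʳ (zeroˡ g′) ⟨
    0# * g′ + combination hs gs     ∎)

  +-∈⟨⟩ᵣ : ∀ {f f′ gs} → f ∈⟨ gs ⟩ᵣ → f′ ∈⟨ gs ⟩ᵣ → f + f′ ∈⟨ gs ⟩ᵣ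
  +-∈⟨⟩ᵣ {gs = gs} (hs , len , f≈) (hs′ , len′ , f′≈) =
    zipWith _+_ hs hs′ ,
    ≡.trans (List.length-zipWith _+_ hs hs′) (≡.trans (≡.cong₂ ℕ._⊓_ len len′) (ℕ.⊓-idem _)) ,
    trans (+-cong f≈ f′≈) (sym (combination-+ hs hs′ gs len len′))

  *-∈⟨⟩ᵣ : ∀ a {f gs} → f ∈⟨ gs ⟩ᵣ → a * f ∈⟨ gs ⟩ᵣ
  *-∈⟨⟩ᵣ a {gs = gs} (hs , len , f≈) =
    map (a *_) hs , ≡.trans (List.length-map (a *_) hs) len ,
    trans (*-congˡ f≈) (sym (combination-*ˡ a hs gs))

  -‿∈⟨⟩ᵣ : ∀ {f gs} → f ∈⟨ gs ⟩ᵣ → - f ∈⟨ gs ⟩ᵣ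
  -‿∈⟨⟩ᵣ f∈ = ∈⟨⟩ᵣ-resp-≈ (-1*x≈-x _) (*-∈⟨⟩ᵣ (- 1#) f∈)

  sum-∈⟨⟩ᵣ : ∀ {m gs} (x : Fin m → Carrier) → (∀ i → x i ∈⟨ gs ⟩ᵣ) → sum x ∈⟨ gs ⟩ᵣ
  sum-∈⟨⟩ᵣ {zero} {gs} x x∈ = 0∈⟨⟩ᵣ gs
  sum-∈⟨⟩ᵣ {suc m} x x∈ = +-∈⟨⟩ᵣ (x∈ zero) (sum-∈⟨⟩ᵣ (λ i → x (suc i)) (λ i → x∈ (suc i)))

  ⟨⟩ᵣ-⊆ : ∀ {gs gs′} → (∀ {g} → g ∈ gs → g ∈⟨ gs′ ⟩ᵣ) → ∀ {f} → f ∈⟨ gs ⟩ᵣ → f ∈⟨ gs′ ⟩ᵣ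
  ⟨⟩ᵣ-⊆ {gs} {gs′} gs⊆ (hs , len , f≈) = ∈⟨⟩ᵣ-resp-≈ (sym f≈) (combination-∈ hs gs len gs⊆)
    where
    combination-∈ : ∀ hs gs → length hs ≡ length gs → (∀ {g} → g ∈ gs → g ∈⟨ gs′ ⟩ᵣ) →
                    combination hs gs ∈⟨ gs′ ⟩ᵣ
    combination-∈ [] [] _ _ = 0∈⟨⟩ᵣ gs′
    combination-∈ (h ∷ hs) (g ∷ gs) len gs⊆ =
      +-∈⟨⟩ᵣ (*-∈⟨⟩ᵣ h (gs⊆ (here ≡.refl))) (combination-∈ hs gs (ℕ.suc-injective len) (gs⊆ ∘ there))

module PolynomialRing {c ℓ} (K : CommutativeRing c ℓ) where
  open RingIdentities K using (x≈c*[x+x])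
  open CommutativeRing K
  open import Algebra.Properties.AbelianGroup +-abelianGroup using (⁻¹-∙-comm; ε⁻¹≈ε)
  open import Algebra.Properties.CommutativeSemigroup +-commutativeSemigroup using (interchange)

  -- Coefficientwise equality, as _≈P_, but wrapped in a record so that its arguments can be inferred.
  infix 4 _≋_
  record _≋_ (p q : Poly K n) : Set ℓ where
    constructor coeffwise
    field coeff-≈ : ∀ e → coeff K p e ≈ coeff K q e
  open _≋_ public

  ≋-isEquivalence : IsEquivalence (_≋_ {n})
  ≋-isEquivalence = record
    { refl  = coeffwise λ _ → refl
    ; sym   = λ p≋q → coeffwise λ e → sym (coeff-≈ p≋q e)
    ; trans = λ p≋q q≋r → coeffwise λ e → trans (coeff-≈ p≋q e) (coeff-≈ q≋r e)
    }

  ≋-setoid : ℕ → Setoid c ℓ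
  ≋-setoid n = record { isEquivalence = ≋-isEquivalence {n} }

  module ≋-Reasoning {n} = SetoidReasoning (≋-setoid n)
  module ≋ {n} = IsEquivalence (≋-isEquivalence {n})

  coeff-++ : (p q : Poly K n) (e : Vec ℕ n) → coeff K (p ++ q) e ≈ coeff K p e + coeff K q e
  coeff-++ [] q e = sym (+-identityˡ _)
  coeff-++ ((a , d) ∷ p) q e with Vec.≡-dec ℕ._≟_ d e
  ... | yes _ = trans (+-congˡ (coeff-++ p q e)) (sym (+-assoc _ _ _))
  ... | no _ = coeff-++ p q e

  ++-cong : {p p′ q q′ : Poly K n} → p ≋ p′ → q ≋ q′ → p ++ q ≋ p′ ++ q′
  ++-cong {p = p} {p′} {q} {q′} p≋p′ q≋q′ = coeffwise λ e → begin
    coeff K (p ++ q) e          ≈⟨ coeff-++ p q e ⟩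
    coeff K p e + coeff K q e   ≈⟨ +-cong (coeff-≈ p≋p′ e) (coeff-≈ q≋q′ e) ⟩
    coeff K p′ e + coeff K q′ e ≈⟨ coeff-++ p′ q′ e ⟨
    coeff K (p′ ++ q′) e        ∎
    where open SetoidReasoning setoid

  ∷-cong : ∀ {a a′} {d d′ : Vec ℕ n} {p p′} → a ≈ a′ → d ≡ d′ → p ≋ p′ → (a , d) ∷ p ≋ (a′ , d′) ∷ p′
  ∷-cong {a = a} {a′} {d} {p = p} {p′} a≈a′ ≡.refl p≋p′ = coeffwise go
    where
    go : ∀ e → coeff K ((a , d) ∷ p) e ≈ coeff K ((a′ , d) ∷ p′) e
    go e with Vec.≡-dec ℕ._≟_ d e
    ... | yes _ = +-cong a≈a′ (coeff-≈ p≋p′ e)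
    ... | no _ = coeff-≈ p≋p′ e

  negate : Poly K n → Poly K n
  negate [] = []
  negate ((a , d) ∷ p) = (- a , d) ∷ negate p

  coeff-negate : (p : Poly K n) (e : Vec ℕ n) → coeff K (negate p) e ≈ - coeff K p e
  coeff-negate [] e = sym ε⁻¹≈ε
  coeff-negate ((a , d) ∷ p) e with Vec.≡-dec ℕ._≟_ d e
  ... | yes _ = trans (+-congˡ (coeff-negate p e)) (⁻¹-∙-comm a (coeff K p e))
  ... | no _ = coeff-negate p e

  scale : Carrier → Vec ℕ n → Poly K n → Poly K n
  scale a d [] = []
  scale a d ((b , e) ∷ q) = (a * b , d +ᵉ e) ∷ scale a d q

  coeff-scale-+ᵉ : ∀ a (d x : Vec ℕ n) q → coeff K (scale a d q) (d +ᵉ x) ≈ a * coeff K q x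
  coeff-scale-+ᵉ a d x [] = sym (zeroʳ a)
  coeff-scale-+ᵉ a d x ((b , e) ∷ q)
    with Vec.≡-dec ℕ._≟_ (d +ᵉ e) (d +ᵉ x) | Vec.≡-dec ℕ._≟_ e x
  ... | yes _  | yes _   = trans (+-congˡ (coeff-scale-+ᵉ a d x q)) (sym (distribˡ a b _))
  ... | yes eq | no e≢x  = ⊥-elim (e≢x (+ᵉ-cancelˡ d e x eq))
  ... | no neq | yes e≡x = ⊥-elim (neq (≡.cong (d +ᵉ_) e≡x))
  ... | no _   | no _    = coeff-scale-+ᵉ a d x q

  coeff-scale-∤ : ∀ a (d e : Vec ℕ n) → (∀ x → d +ᵉ x ≢ e) → ∀ q → coeff K (scale a d q) e ≈ 0#
  coeff-scale-∤ a d e d∤e [] = refl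
  coeff-scale-∤ a d e d∤e ((b , e′) ∷ q) with Vec.≡-dec ℕ._≟_ (d +ᵉ e′) e
  ... | yes eq = ⊥-elim (d∤e e′ eq)
  ... | no _ = coeff-scale-∤ a d e d∤e q

  scale-cong : ∀ a (d : Vec ℕ n) {q q′} → q ≋ q′ → scale a d q ≋ scale a d q′
  scale-cong a d {q} {q′} q≋q′ = coeffwise go
    where
    go : ∀ e → coeff K (scale a d q) e ≈ coeff K (scale a d q′) e
    go e with +ᵉ-divides? d e
    ... | inj₁ (x , ≡.refl) = begin
      coeff K (scale a d q) (d +ᵉ x)  ≈⟨ coeff-scale-+ᵉ a d x q ⟩
      a * coeff K q x                 ≈⟨ *-congˡ (coeff-≈ q≋q′ x) ⟩
      a * coeff K q′ x                ≈⟨ coeff-scale-+ᵉ a d x q′ ⟨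
      coeff K (scale a d q′) (d +ᵉ x) ∎
      where open SetoidReasoning setoid
    ... | inj₂ d∤e = trans (coeff-scale-∤ a d e d∤e q) (sym (coeff-scale-∤ a d e d∤e q′))

  scale-++ : ∀ a (d : Vec ℕ n) q r → scale a d (q ++ r) ≡ scale a d q ++ scale a d r
  scale-++ a d [] r = ≡.refl
  scale-++ a d (t ∷ q) r = ≡.cong (_ ∷_) (scale-++ a d q r)

  scale-scale : ∀ a b (d e : Vec ℕ n) r → scale (a * b) (d +ᵉ e) r ≋ scale a d (scale b e r)
  scale-scale a b d e [] = ≋.refl
  scale-scale a b d e ((c′ , f) ∷ r) =
    ∷-cong (*-assoc a b c′) (Vec.zipWith-assoc ℕ.+-assoc d e f) (scale-scale a b d e r)

  ++-interchange : (p q r s : Poly K n) → (p ++ q) ++ (r ++ s) ≋ (p ++ r) ++ (q ++ s)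
  ++-interchange p q r s = coeffwise λ e → begin
    coeff K ((p ++ q) ++ (r ++ s)) e  ≈⟨ coeff-++₄ e p q r s ⟩
    _                                 ≈⟨ interchange _ _ _ _ ⟩
    _                                 ≈⟨ coeff-++₄ e p r q s ⟨
    coeff K ((p ++ r) ++ (q ++ s)) e  ∎
    where
    open SetoidReasoning setoid
    coeff-++₄ : ∀ e p q r s → coeff K ((p ++ q) ++ (r ++ s)) e
                            ≈ (coeff K p e + coeff K q e) + (coeff K r e + coeff K s e)
    coeff-++₄ e p q r s = trans (coeff-++ (p ++ q) (r ++ s) e) (+-cong (coeff-++ p q e) (coeff-++ r s e))

  -- _*P_ is reasoned about through this structurally recursive version.
  mul : Poly K n → Poly K n → Poly K n
  mul [] q = []
  mul ((a , d) ∷ p) q = scale a d q ++ mul p q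

  map≡scale : ∀ a (d : Vec ℕ n) f → (∀ b e → f (b , e) ≡ (a * b , d +ᵉ e)) → ∀ q → map f q ≡ scale a d q
  map≡scale a d f f≗ [] = ≡.refl
  map≡scale a d f f≗ ((b , e) ∷ q) = ≡.cong₂ _∷_ (f≗ b e) (map≡scale a d f f≗ q)

  *P≡mul : (p q : Poly K n) → _*P_ K p q ≡ mul p q
  *P≡mul [] q = ≡.refl
  *P≡mul ((a , d) ∷ p) q = ≡.cong₂ _++_ (map≡scale a d _ (λ _ _ → ≡.refl) q) (*P≡mul p q)

  mul-zeroʳ : (p : Poly K n) → mul p [] ≡ []
  mul-zeroʳ [] = ≡.refl
  mul-zeroʳ (t ∷ p) = mul-zeroʳ p

  mul-congʳ : (p : Poly K n) {q q′ : Poly K n} → q ≋ q′ → mul p q ≋ mul p q′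
  mul-congʳ [] q≋q′ = ≋.refl
  mul-congʳ ((a , d) ∷ p) q≋q′ = ++-cong (scale-cong a d q≋q′) (mul-congʳ p q≋q′)

  mul-distribʳ : (p q r : Poly K n) → mul (p ++ q) r ≡ mul p r ++ mul q r
  mul-distribʳ [] q r = ≡.refl
  mul-distribʳ ((a , d) ∷ p) q r =
    ≡.trans (≡.cong (scale a d r ++_) (mul-distribʳ p q r)) (≡.sym (List.++-assoc (scale a d r) _ _))

  mul-distribˡ : (p q r : Poly K n) → mul p (q ++ r) ≋ mul p q ++ mul p r
  mul-distribˡ [] q r = ≋.refl
  mul-distribˡ ((a , d) ∷ p) q r = begin
    scale a d (q ++ r) ++ mul p (q ++ r)
      ≈⟨ ++-cong (≋.reflexive (scale-++ a d q r)) (mul-distribˡ p q r) ⟩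
    (scale a d q ++ scale a d r) ++ (mul p q ++ mul p r)
      ≈⟨ ++-interchange (scale a d q) (scale a d r) (mul p q) (mul p r) ⟩
    (scale a d q ++ mul p q) ++ (scale a d r ++ mul p r) ∎
    where open ≋-Reasoning

  mul-scale : ∀ a (d : Vec ℕ n) q r → mul (scale a d q) r ≋ scale a d (mul q r)
  mul-scale a d [] r = ≋.refl
  mul-scale a d ((b , e) ∷ q) r = begin
    scale (a * b) (d +ᵉ e) r ++ mul (scale a d q) r
      ≈⟨ ++-cong (scale-scale a b d e r) (mul-scale a d q r) ⟩
    scale a d (scale b e r) ++ scale a d (mul q r)
      ≡⟨ scale-++ a d (scale b e r) (mul q r) ⟨
    scale a d (scale b e r ++ mul q r) ∎
    where open ≋-Reasoning

  mul-assoc : (p q r : Poly K n) → mul (mul p q) r ≋ mul p (mul q r)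
  mul-assoc [] q r = ≋.refl
  mul-assoc ((a , d) ∷ p) q r = begin
    mul (scale a d q ++ mul p q) r          ≡⟨ mul-distribʳ (scale a d q) (mul p q) r ⟩
    mul (scale a d q) r ++ mul (mul p q) r  ≈⟨ ++-cong (mul-scale a d q r) (mul-assoc p q r) ⟩
    scale a d (mul q r) ++ mul p (mul q r)  ∎
    where open ≋-Reasoning

  mul-monomialʳ : ∀ a (d : Vec ℕ n) q → mul q ((a , d) ∷ []) ≋ scale a d q
  mul-monomialʳ a d [] = ≋.refl
  mul-monomialʳ a d ((b , e) ∷ q) =
    ∷-cong (*-comm b a) (Vec.zipWith-comm ℕ.+-comm e d) (mul-monomialʳ a d q)

  mul-comm : (p q : Poly K n) → mul p q ≋ mul q p
  mul-comm [] q = ≋.reflexive (≡.sym (mul-zeroʳ q))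
  mul-comm ((a , d) ∷ p) q = begin
    scale a d q ++ mul p q               ≈⟨ ++-cong (mul-monomialʳ a d q) (≋.sym (mul-comm p q)) ⟨
    mul q ((a , d) ∷ []) ++ mul q p      ≈⟨ mul-distribˡ q ((a , d) ∷ []) p ⟨
    mul q ((a , d) ∷ p)                  ∎
    where open ≋-Reasoning

  mul-congˡ : {p p′ : Poly K n} (q : Poly K n) → p ≋ p′ → mul p q ≋ mul p′ q
  mul-congˡ {p = p} {p′} q p≋p′ = begin
    mul p q   ≈⟨ mul-comm p q ⟩
    mul q p   ≈⟨ mul-congʳ q p≋p′ ⟩
    mul q p′  ≈⟨ mul-comm q p′ ⟩
    mul p′ q  ∎
    where open ≋-Reasoning

  constant : Carrier → Poly K n
  constant {n} a = (a , Vec.replicate n 0) ∷ []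

  coeff-constant-mul : ∀ a (p : Poly K n) e → coeff K (mul (constant a) p) e ≈ a * coeff K p e
  coeff-constant-mul {n} a p e = begin
    coeff K (scale a 0ᵉ p ++ []) e   ≈⟨ coeff-++ (scale a 0ᵉ p) [] e ⟩
    coeff K (scale a 0ᵉ p) e + 0#    ≈⟨ +-identityʳ _ ⟩
    coeff K (scale a 0ᵉ p) e         ≡⟨ ≡.cong (coeff K (scale a 0ᵉ p)) (Vec.zipWith-identityˡ ℕ.+-identityˡ e) ⟨
    coeff K (scale a 0ᵉ p) (0ᵉ +ᵉ e) ≈⟨ coeff-scale-+ᵉ a 0ᵉ e p ⟩
    a * coeff K p e                  ∎
    where
    open SetoidReasoning setoid
    0ᵉ : Vec ℕ n
    0ᵉ = Vec.replicate n 0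

  mul-identityˡ : (p : Poly K n) → mul (constant 1#) p ≋ p
  mul-identityˡ p = coeffwise λ e → trans (coeff-constant-mul 1# p e) (*-identityˡ _)

  ++-comm : (p q : Poly K n) → p ++ q ≋ q ++ p
  ++-comm p q = coeffwise λ e →
    trans (coeff-++ p q e) (trans (+-comm _ _) (sym (coeff-++ q p e)))

  negate-inverseˡ : (p : Poly K n) → negate p ++ p ≋ []
  negate-inverseˡ p = coeffwise λ e →
    trans (coeff-++ (negate p) p e) (trans (+-congʳ (coeff-negate p e)) (-‿inverseˡ _))

  negate-cong : {p q : Poly K n} → p ≋ q → negate p ≋ negate q
  negate-cong {p = p} {q} p≋q = coeffwise λ e →
    trans (coeff-negate p e) (trans (-‿cong (coeff-≈ p≋q e)) (sym (coeff-negate q e)))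

  *P-cong : {p p′ q q′ : Poly K n} → p ≋ p′ → q ≋ q′ → _*P_ K p q ≋ _*P_ K p′ q′
  *P-cong {p = p} {p′} {q} {q′} p≋p′ q≋q′
    rewrite *P≡mul p q | *P≡mul p′ q′ = ≋.trans (mul-congˡ q p≋p′) (mul-congʳ p′ q≋q′)

  *P-assoc : (p q r : Poly K n) → _*P_ K (_*P_ K p q) r ≋ _*P_ K p (_*P_ K q r)
  *P-assoc p q r rewrite *P≡mul p q | *P≡mul q r | *P≡mul (mul p q) r | *P≡mul p (mul q r) =
    mul-assoc p q r

  *P-comm : (p q : Poly K n) → _*P_ K p q ≋ _*P_ K q p
  *P-comm p q rewrite *P≡mul p q | *P≡mul q p = mul-comm p q

  *P-identityˡ : (p : Poly K n) → _*P_ K (constant 1#) p ≋ p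
  *P-identityˡ p rewrite *P≡mul (constant 1#) p = mul-identityˡ p

  *P-distribˡ : (p q r : Poly K n) → _*P_ K p (q ++ r) ≋ _*P_ K p q ++ _*P_ K p r
  *P-distribˡ p q r rewrite *P≡mul p (q ++ r) | *P≡mul p q | *P≡mul p r = mul-distribˡ p q r

  coeff-constant-*P : ∀ a (p : Poly K n) e → coeff K (_*P_ K (constant a) p) e ≈ a * coeff K p e
  coeff-constant-*P a p e rewrite *P≡mul (constant a) p = coeff-constant-mul a p e

  polynomialRing : ℕ → CommutativeRing c ℓ
  polynomialRing n = record
    { Carrier = Poly K n
    ; _≈_     = _≋_
    ; _+_     = _+P_ K
    ; _*_     = _*P_ K
    ; -_      = negate
    ; 0#      = 0P K
    ; 1#      = constant 1#
    ; isCommutativeRing = record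
      { isRing = record
        { +-isAbelianGroup = record
          { isGroup = record
            { isMonoid = record
              { isSemigroup = record
                { isMagma = record { isEquivalence = ≋-isEquivalence ; ∙-cong = ++-cong }
                ; assoc   = λ p q r → ≋.reflexive (List.++-assoc p q r)
                }
              ; identity = (λ _ → ≋.refl) , λ p → ≋.reflexive (List.++-identityʳ p)
              }
            ; inverse = negate-inverseˡ , λ p → ≋.trans (++-comm p (negate p)) (negate-inverseˡ p)
            ; ⁻¹-cong = negate-cong
            }
          ; comm = ++-comm
          }
        ; *-cong     = *P-cong
        ; *-assoc    = *P-assoc
        ; *-identity = comm∧idˡ⇒id (≋-setoid n) *P-comm *P-identityˡ
        ; distrib    = comm∧distrˡ⇒distr (≋-setoid n) ++-cong *P-comm *P-distribˡ
        }
      ; *-comm = *P-comm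
      }
    }

  constant-*-[1+1]≈1 : ∀ {c} → c * (1# + 1#) ≈ 1# →
    _*P_ K (constant {n} c) (constant 1# ++ constant 1#) ≋ constant 1#
  constant-*-[1+1]≈1 {n} {c} c*2≈1 = coeffwise λ e → begin
    coeff K (_*P_ K (constant c) (one ++ one)) e ≈⟨ coeff-constant-*P c (one ++ one) e ⟩
    c * coeff K (one ++ one) e                 ≈⟨ *-congˡ (coeff-++ one one e) ⟩
    c * (coeff K one e + coeff K one e)        ≈⟨ x≈c*[x+x] c*2≈1 (coeff K one e) ⟨
    coeff K one e                              ∎
    where
    open SetoidReasoning setoid
    one : Poly K n
    one = constant 1#

  module _ {n : ℕ} where
    open Ideal (polynomialRing n) using (_∈⟨_⟩ᵣ)

    ∈⟨⟩⇒∈⟨⟩ᵣ : ∀ {f gs} → _∈⟨_⟩ K f gs → f ∈⟨ gs ⟩ᵣ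
    ∈⟨⟩⇒∈⟨⟩ᵣ (hs , len , f≈) = hs , len , coeffwise f≈

    ∈⟨⟩ᵣ⇒∈⟨⟩ : ∀ {f gs} → f ∈⟨ gs ⟩ᵣ → _∈⟨_⟩ K f gs
    ∈⟨⟩ᵣ⇒∈⟨⟩ (hs , len , f≈) = hs , len , coeff-≈ f≈

module Generators {c ℓ} (K : CommutativeRing c ℓ) (m : ℕ) where
  open PolynomialRing K using (polynomialRing)
  open CommutativeRing (polynomialRing (suc m)) hiding (zero)
  open import Algebra.Properties.AbelianGroup +-abelianGroup using (x≈z//y)
  open import Algebra.Properties.Semiring.Sum semiring
  open RingIdentities (polynomialRing (suc m))
  open Ideal (polynomialRing (suc m))
  open SetoidReasoning setoid

  -- In K[y₁, …, y_{m+1}], y i is the variable y_{i+2}.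
  y₁ : Poly K (suc m)
  y₁ = var K zero

  y : Fin m → Poly K (suc m)
  y i = var K (suc i)

  s q g₀₁₁ : Poly K (suc m)
  s = sum y
  q = ∑[ i < m ] (y i * y i)
  g₀₁₁ = g011 K (suc m)

  concat-map-allFin : ∀ {k} (f : Fin k → Poly K (suc m)) → concat (map f (allFin k)) ≡ sum f
  concat-map-allFin f = ≡.trans (≡.cong concat (List.map-tabulate (λ i → i) f)) (concat-tabulate f)
    where
    concat-tabulate : ∀ {k} (f : Fin k → Poly K (suc m)) → concat (tabulate f) ≡ sum f
    concat-tabulate {zero} f = ≡.refl
    concat-tabulate {suc k} f = ≡.cong (f zero +_) (concat-tabulate (λ i → f (suc i)))

  g1≡y₁+s : g1 K (suc m) ≡ y₁ + s
  g1≡y₁+s = concat-map-allFin (var K)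

  g₀₁₁≈∑<yy : g₀₁₁ ≈ ∑< (λ i j → y i * y j)
  g₀₁₁≈∑<yy = begin
    g₀₁₁                                                   ≡⟨ List.concat-concat rows ⟨
    concat (map concat rows)                               ≡⟨ ≡.cong concat (List.map-∘ (allFin (suc m))) ⟨
    concat (map row (allFin (suc m)))                      ≡⟨ concat-map-allFin row ⟩
    ∑[ i < suc m ] row i                                   ≡⟨ sum-cong-≗ (λ i → concat-map-allFin (term i)) ⟩
    ∑[ i < suc m ] ∑[ j < suc m ] term i j
      ≈⟨ +-cong (sum-replicate-zero (suc m)) (sum-cong-≋ {m} (λ _ → +-identityˡ _)) ⟩
    0# + ∑< (λ i j → y i * y j)                            ≈⟨ +-identityˡ _ ⟩
    ∑< (λ i j → y i * y j)                                 ∎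
    where
    term : Fin (suc m) → Fin (suc m) → Poly K (suc m)
    term i j = if does (1 ℕ.≤? toℕ i) ∧ does (toℕ i ℕ.<? toℕ j) then var K i * var K j else 0#
    row : Fin (suc m) → Poly K (suc m)
    row i = concat (map (term i) (allFin (suc m)))
    rows : List (List (Poly K (suc m)))
    rows = map (λ i → map (term i) (allFin (suc m))) (allFin (suc m))

  s*s≈q+2g₀₁₁ : s * s ≈ q + (g₀₁₁ + g₀₁₁)
  s*s≈q+2g₀₁₁ = trans (square-of-sum y) (+-congˡ {q} (+-cong (sym g₀₁₁≈∑<yy) (sym g₀₁₁≈∑<yy)))

  2g₀₁₁≈s*s-q : g₀₁₁ + g₀₁₁ ≈ s * s - q
  2g₀₁₁≈s*s-q = x≈z//y (g₀₁₁ + g₀₁₁) q (s * s) (trans (+-comm (g₀₁₁ + g₀₁₁) q) (sym s*s≈q+2g₀₁₁))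

  square-unless-first : Fin (suc m) → List (Poly K (suc m))
  square-unless-first i = if does (1 ℕ.≤? toℕ i) then var K i * var K i ∷ [] else []

  private
    F₁ I : List (Poly K (suc m))
    F₁ = F1 K (suc m)
    I = I-gens K (suc m)

  y²∈F₁ : ∀ i → y i * y i ∈ F₁
  y²∈F₁ i = there (there (∈-concatMap⁺ square-unless-first (lose (∈-allFin (suc i)) (here ≡.refl))))

  y₁+s∈⟨F₁⟩ : y₁ + s ∈⟨ F₁ ⟩ᵣ
  y₁+s∈⟨F₁⟩ = ∈⟨⟩ᵣ-resp-≈ (reflexive g1≡y₁+s) (∈⇒∈⟨⟩ᵣ (here ≡.refl))

  s*s∈⟨F₁⟩ : s * s ∈⟨ F₁ ⟩ᵣ
  s*s∈⟨F₁⟩ = ∈⟨⟩ᵣ-resp-≈ (sym s*s≈q+2g₀₁₁)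
    (+-∈⟨⟩ᵣ (sum-∈⟨⟩ᵣ (λ i → y i * y i) (∈⇒∈⟨⟩ᵣ ∘ y²∈F₁)) (+-∈⟨⟩ᵣ g₀₁₁∈⟨F₁⟩ g₀₁₁∈⟨F₁⟩))
    where
    g₀₁₁∈⟨F₁⟩ : g₀₁₁ ∈⟨ F₁ ⟩ᵣ
    g₀₁₁∈⟨F₁⟩ = ∈⇒∈⟨⟩ᵣ (there (here ≡.refl))

  y₁*y₁∈⟨F₁⟩ : y₁ * y₁ ∈⟨ F₁ ⟩ᵣ
  y₁*y₁∈⟨F₁⟩ = ∈⟨⟩ᵣ-resp-≈ (sym (x*x≈x*[x+y]+y*y-y*[x+y] y₁ s))
    (+-∈⟨⟩ᵣ (+-∈⟨⟩ᵣ (*-∈⟨⟩ᵣ y₁ y₁+s∈⟨F₁⟩) s*s∈⟨F₁⟩) (-‿∈⟨⟩ᵣ (*-∈⟨⟩ᵣ s y₁+s∈⟨F₁⟩)))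

  I⊆⟨F₁⟩ : ∀ {g} → g ∈ I → g ∈⟨ F₁ ⟩ᵣ
  I⊆⟨F₁⟩ (here ≡.refl) = ∈⇒∈⟨⟩ᵣ (here ≡.refl)
  I⊆⟨F₁⟩ (there g∈) with ∈-map⁻ (λ i → var K i * var K i) {xs = allFin (suc m)} g∈
  ... | zero  , _ , ≡.refl = y₁*y₁∈⟨F₁⟩
  ... | suc i , _ , ≡.refl = ∈⇒∈⟨⟩ᵣ (y²∈F₁ i)

  x²∈I : ∀ i → var K i * var K i ∈ I
  x²∈I i = there (∈-map⁺ (λ i → var K i * var K i) (∈-allFin i))

  y₁+s∈⟨I⟩ : y₁ + s ∈⟨ I ⟩ᵣ
  y₁+s∈⟨I⟩ = ∈⟨⟩ᵣ-resp-≈ (reflexive g1≡y₁+s) (∈⇒∈⟨⟩ᵣ (here ≡.refl))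

  s*s∈⟨I⟩ : s * s ∈⟨ I ⟩ᵣ
  s*s∈⟨I⟩ = ∈⟨⟩ᵣ-resp-≈ (sym (y*y≈[x+y]*[x+y]+x*x-[x+x]*[x+y] y₁ s))
    (+-∈⟨⟩ᵣ (+-∈⟨⟩ᵣ (*-∈⟨⟩ᵣ (y₁ + s) y₁+s∈⟨I⟩) (∈⇒∈⟨⟩ᵣ (x²∈I zero)))
            (-‿∈⟨⟩ᵣ (*-∈⟨⟩ᵣ (y₁ + y₁) y₁+s∈⟨I⟩)))

  2g₀₁₁∈⟨I⟩ : g₀₁₁ + g₀₁₁ ∈⟨ I ⟩ᵣ
  2g₀₁₁∈⟨I⟩ = ∈⟨⟩ᵣ-resp-≈ (sym 2g₀₁₁≈s*s-q)
    (+-∈⟨⟩ᵣ s*s∈⟨I⟩ (-‿∈⟨⟩ᵣ (sum-∈⟨⟩ᵣ (λ i → y i * y i) (∈⇒∈⟨⟩ᵣ ∘ x²∈I ∘ suc))))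

  module _ (½ : Poly K (suc m)) (½*2≈1 : ½ * (1# + 1#) ≈ 1#) where

    F₁⊆⟨I⟩ : ∀ {g} → g ∈ F₁ → g ∈⟨ I ⟩ᵣ
    F₁⊆⟨I⟩ (here ≡.refl) = ∈⇒∈⟨⟩ᵣ (here ≡.refl)
    F₁⊆⟨I⟩ (there (here ≡.refl)) =
      ∈⟨⟩ᵣ-resp-≈ (sym (x≈c*[x+x] {½} ½*2≈1 g₀₁₁)) (*-∈⟨⟩ᵣ ½ 2g₀₁₁∈⟨I⟩)
    F₁⊆⟨I⟩ (there (there g∈)) with satisfied (∈-concatMap⁻ square-unless-first {xs = allFin (suc m)} g∈)
    ... | i , g∈ = guarded i (does (1 ℕ.≤? toℕ i)) g∈
      where
      guarded : ∀ {g} i b → g ∈ (if b then var K i * var K i ∷ [] else []) → g ∈⟨ I ⟩ᵣ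
      guarded i true (here ≡.refl) = ∈⇒∈⟨⟩ᵣ (x²∈I i)

lemma2p1 : ∀ {c ℓ} (K : CommutativeRing c ℓ) → IsField K → CharZero K →
    (n : ℕ) → 0 < n → SameIdeal K (I-gens K n) (F1 K n)
lemma2p1 K _ _ zero ()
lemma2p1 K (_ , inverse) char0 (suc m) _ f =
    (λ f∈I → ∈⟨⟩ᵣ⇒∈⟨⟩ {f = f} (⟨⟩ᵣ-⊆ I⊆⟨F₁⟩ (∈⟨⟩⇒∈⟨⟩ᵣ {f = f} f∈I)))
  , (λ f∈F₁ → ∈⟨⟩ᵣ⇒∈⟨⟩ {f = f} (⟨⟩ᵣ-⊆ F₁⊆⟨I⟩′ (∈⟨⟩⇒∈⟨⟩ᵣ {f = f} f∈F₁)))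
  where
  open CommutativeRing K
  open PolynomialRing K using (polynomialRing; constant; constant-*-[1+1]≈1; ∈⟨⟩⇒∈⟨⟩ᵣ; ∈⟨⟩ᵣ⇒∈⟨⟩)
  open Ideal (polynomialRing (suc m)) using (_∈⟨_⟩ᵣ; ⟨⟩ᵣ-⊆)
  open Generators K m using (I⊆⟨F₁⟩; F₁⊆⟨I⟩)

  ½ : Carrier
  ½ = proj₁ (inverse (natR K 2) (char0 1))

  ½*2≈1 : ½ * (1# + 1#) ≈ 1#
  ½*2≈1 = trans (*-comm ½ _)
            (trans (*-congʳ (+-congˡ (sym (+-identityʳ 1#)))) (proj₂ (inverse (natR K 2) (char0 1))))

  F₁⊆⟨I⟩′ : ∀ {g} → g ∈ F1 K (suc m) → g ∈⟨ I-gens K (suc m) ⟩ᵣ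
  F₁⊆⟨I⟩′ = F₁⊆⟨I⟩ (constant ½) (constant-*-[1+1]≈1 ½*2≈1)
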